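{- Let $n\geq 1$ and $m\geq 1$ with $(n,m)\notin\{(1,1),(1,2),(2,1)\}$. Then there exists an $n\times m$ min-$2$TDS matrix $M$ such that either $M=B(3,3)$ up to permutations of rows and columns, or every component of $M$, up to permutations of rows and columns, is one of: $J(x,1)$ with $x\geq 3$, $J(1,y)$ with $y\geq 3$, $J(x,2)$ with $x\geq 2$, or $J(2,y)$ with $y\geq 2$.
   Context: For an $n\times m$ $(0,1)$-matrix $M=(m_{ij})$, define $\kappa(i,j)$ as the $i$-th row sum plus the $j$-th column sum minus $2m_{ij}$; $M$ is a $k$TDS matrix if $\kappa(i,j)\geq k$ for all cells. A min-$k$TDS matrix is an $n\times m$ $k$TDS matrix whose number of ones is the minimum possible among all $n\times m$ $k$TDS matrices (this minimum equals $\gamma_{\times k,t}(K_n\Box K_m)$, the $k$-tuple total domination number of the rook's graph). Given $M$, let $\Gamma(M)$ be the graph whose vertices are the positions of the ones of $M$, two ones adjacent iff they lie in the same row or column with no other one strictly between them. The components of $M$ are the connected components of $\Gamma(M)$, each identified with the submatrix of $M$ on the rows and columns its ones meet. $J(x,y)$ denotes the $x\times y$ all-ones matrix; $B(3,3)$ is the $3\times 3$ $(0,1)$-matrix whose first row and first column are all ones and all other entries are $0$. -}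

module Defs where

open import Data.Nat using (ℕ; zero; suc; _+_; _*_; _∸_; _≤_; _<_; _≥_)
open import Data.Bool using (Bool; true; false)
open import Data.Fin using (Fin; toℕ)
import Data.Fin as F
open import Data.Product using (Σ; ∃; ∃-syntax; _×_; _,_)
open import Data.Sum using (_⊎_)
open import Data.Unit using (⊤)
open import Relation.Binary.PropositionalEquality using (_≡_; _≢_)
open import Relation.Binary.Construct.Closure.ReflexiveTransitive using (Star)
open import Function using (_⇔_)
open import Function.Definitions using (Injective)
open import Relation.Nullary using (¬_)

Matrix : ℕ → ℕ → Set
Matrix n m = Fin n → Fin m → Bool

b2n : Bool → ℕ
b2n true  = 1
b2n false = 0

sumFin : (n : ℕ) → (Fin n → ℕ) → ℕ
sumFin zero    f = 0
sumFin (suc n) f = f F.zero + sumFin n (λ i → f (F.suc i))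

rowSum : ∀ {n m} → Matrix n m → Fin n → ℕ
rowSum {n} {m} M i = sumFin m (λ j → b2n (M i j))

colSum : ∀ {n m} → Matrix n m → Fin m → ℕ
colSum {n} {m} M j = sumFin n (λ i → b2n (M i j))

ones : ∀ {n m} → Matrix n m → ℕ
ones {n} {m} M = sumFin n (λ i → rowSum M i)

-- κ(i,j) = rowSum i + colSum j − 2 m_ij  (never truncated, as m_ij is counted in both sums)
κ : ∀ {n m} → Matrix n m → Fin n → Fin m → ℕ
κ M i j = (rowSum M i + colSum M j) ∸ (2 * b2n (M i j))

IsKTDS : ∀ {n m} → ℕ → Matrix n m → Set
IsKTDS k M = ∀ i j → κ M i j ≥ k

IsMinKTDS : ∀ {n m} → ℕ → Matrix n m → Set
IsMinKTDS {n} {m} k M = IsKTDS k M × (∀ (M' : Matrix n m) → IsKTDS k M' → ones M ≤ ones M')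

Pos : ℕ → ℕ → Set
Pos n m = Fin n × Fin m

StrictlyBetween : ℕ → ℕ → ℕ → Set
StrictlyBetween a b c = (a < b × b < c) ⊎ (c < b × b < a)

-- Edges of Γ(M): two distinct ones in the same row (resp. column) with no one strictly between them
data Adj {n m : ℕ} (M : Matrix n m) : Pos n m → Pos n m → Set where
  sameRow : ∀ {i j j'} → M i j ≡ true → M i j' ≡ true → j ≢ j' →
            (∀ (j'' : Fin m) → StrictlyBetween (toℕ j) (toℕ j'') (toℕ j') → M i j'' ≡ false) →
            Adj M (i , j) (i , j')
  sameCol : ∀ {i i' j} → M i j ≡ true → M i' j ≡ true → i ≢ i' →
            (∀ (i'' : Fin n) → StrictlyBetween (toℕ i) (toℕ i'') (toℕ i') → M i'' j ≡ false) →
            Adj M (i , j) (i' , j)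

Reach : ∀ {n m} → Matrix n m → Pos n m → Pos n m → Set
Reach M = Star (Adj M)

CompRows : ∀ {n m} → Matrix n m → Pos n m → Fin n → Set
CompRows {n} {m} M p r = ∃[ c ] (M r c ≡ true × Reach M p (r , c))

CompCols : ∀ {n m} → Matrix n m → Pos n m → Fin m → Set
CompCols {n} {m} M p c = ∃[ r ] (M r c ≡ true × Reach M p (r , c))

SubmatrixPermEq : ∀ {n m x y} → Matrix n m → (Fin n → Set) → (Fin m → Set) → Matrix x y → Set
SubmatrixPermEq {n} {m} {x} {y} M R C A =
  Σ (Fin x → Fin n) λ ρ → Σ (Fin y → Fin m) λ σ →
    Injective _≡_ _≡_ ρ × Injective _≡_ _≡_ σ ×
    (∀ r → R r ⇔ (∃[ a ] ρ a ≡ r)) ×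
    (∀ c → C c ⇔ (∃[ b ] σ b ≡ c)) ×
    (∀ a b → M (ρ a) (σ b) ≡ A a b)

PermEq : ∀ {n m x y} → Matrix n m → Matrix x y → Set
PermEq M A = SubmatrixPermEq M (λ _ → ⊤) (λ _ → ⊤) A

J : (x y : ℕ) → Matrix x y
J x y _ _ = true

B33 : Matrix 3 3
B33 F.zero _      = true
B33 (F.suc _) F.zero = true
B33 (F.suc _) (F.suc _) = false

AllowedShape : ℕ → ℕ → Set
AllowedShape x y = (y ≡ 1 × x ≥ 3) ⊎ (x ≡ 1 × y ≥ 3) ⊎ (y ≡ 2 × x ≥ 2) ⊎ (x ≡ 2 × y ≥ 2)

ComponentAllowed : ∀ {n m} → Matrix n m → Pos n m → Set
ComponentAllowed M p =
  ∃[ x ] ∃[ y ] (AllowedShape x y × SubmatrixPermEq M (CompRows M p) (CompCols M p) (J x y))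

-- every component (each one of M lies in exactly one component)
AllComponentsAllowed : ∀ {n m} → Matrix n m → Set
AllComponentsAllowed M = ∀ i j → M i j ≡ true → ComponentAllowed M (i , j)

module Submission where

-- Weight a line with r ≥ 1 ones by 2r, plus 1 if r = 1; this weight is 3 plus the
-- slack [r = 2] + (r − 3)⁺ plus r·[r ≥ 3].  At a one of a line with a single one, κ ≥ 2 forces the
-- crossing line to hold at least three ones, so the ones of lines with r ≥ 3 pay for the bonuses of
-- the crossing single-one lines.  Summing over rows and columns gives 4·|M| ≥ 3(n + m) when no line
-- is empty, with equality only for n = 3a + b, m = a + 3b; a matrix with an empty row has at least
-- 2m ones.
--
-- For 5n ≤ 3m + 3, J(n,2) padded with zero columns attains 2n (similarly J(1,3)
-- for n = 1).  Otherwise 3m + 4 ≤ 5n and 3n + 4 ≤ 5m, and block-diagonal sums of blocks J(x,1),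
-- J(1,y), built by adding J(3,1) or J(1,3) to a smaller solution down to finitely many base cases,
-- have at most ⌈3(n + m)/4⌉ ones, or one more when equality in the counting bound is impossible.
-- Only (3,3) escapes this, and there B(3,3) attains the bound.

open import Defs
open import Data.Bool using (Bool; true; false; T)
open import Data.Empty using (⊥-elim)
open import Data.Fin as F using (Fin; toℕ; _↑ˡ_; _↑ʳ_)
open import Data.Fin.Properties using (any?; all?; toℕ-inject₁; toℕ-injective; toℕ-↑ˡ; toℕ-↑ʳ; splitAt-↑ˡ; splitAt-↑ʳ)
open import Data.Nat using (ℕ; zero; suc; _+_; _*_; _∸_; _≤_; _<_; _≥_; z≤n; s≤s; _≟_)
open import Data.Nat.Properties
open import Algebra.Properties.Semiring.Sum +-*-semiring using (sum; ∑-distrib-+; ∑-comm; *-distribˡ-sum; *-distribʳ-sum)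
open import Data.Nat.Induction using (<-rec)
open import Data.Nat.Tactic.RingSolver using (solve-∀)
open import Data.Maybe using (Maybe; just; nothing; is-just; to-witness-T)
open import Data.Product using (∃; ∃-syntax; _×_; _,_; swap)
open import Data.Sum using (_⊎_; inj₁; inj₂) renaming (swap to ⊎-swap)
open import Function using (id; _∘_; mk⇔; Equivalence)
open import Data.Fin.Induction using (<-weakInduction)
open import Relation.Binary.Construct.Closure.ReflexiveTransitive using (ε; _◅_; _◅◅_; gmap; revApp)
open import Relation.Binary.PropositionalEquality hiding (J)
open import Relation.Nullary using (¬_; yes; no; contradiction)
open import Relation.Nullary.Decidable using (Dec; from-yes; T?; _×-dec_; _→-dec_; ¬?)

sumFin≡sum : ∀ n (f : Fin n → ℕ) → sumFin n f ≡ sum f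
sumFin≡sum zero    f = refl
sumFin≡sum (suc n) f = cong (f F.zero +_) (sumFin≡sum n (λ i → f (F.suc i)))

sumFin-cong : ∀ n {f g : Fin n → ℕ} → (∀ i → f i ≡ g i) → sumFin n f ≡ sumFin n g
sumFin-cong zero    f≗g = refl
sumFin-cong (suc n) f≗g = cong₂ _+_ (f≗g F.zero) (sumFin-cong n (λ i → f≗g (F.suc i)))

sumFin-mono : ∀ n {f g : Fin n → ℕ} → (∀ i → f i ≤ g i) → sumFin n f ≤ sumFin n g
sumFin-mono zero    f≤g = z≤n
sumFin-mono (suc n) f≤g = +-mono-≤ (f≤g F.zero) (sumFin-mono n (λ i → f≤g (F.suc i)))

sumFin-const : ∀ n k → sumFin n (λ _ → k) ≡ n * k
sumFin-const zero    k = refl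
sumFin-const (suc n) k = cong (k +_) (sumFin-const n k)

sumFin-zero : ∀ n → sumFin n (λ _ → 0) ≡ 0
sumFin-zero n = trans (sumFin-const n 0) (*-zeroʳ n)

sumFin-+ : ∀ n (f g : Fin n → ℕ) → sumFin n (λ i → f i + g i) ≡ sumFin n f + sumFin n g
sumFin-+ n f g rewrite sumFin≡sum n f | sumFin≡sum n g | sumFin≡sum n (λ i → f i + g i) =
  ∑-distrib-+ f g

sumFin-*ʳ : ∀ n (f : Fin n → ℕ) k → sumFin n (λ i → f i * k) ≡ sumFin n f * k
sumFin-*ʳ n f k rewrite sumFin≡sum n f | sumFin≡sum n (λ i → f i * k) = sym (*-distribʳ-sum k f)

sumFin-*ˡ : ∀ n k (f : Fin n → ℕ) → sumFin n (λ i → k * f i) ≡ k * sumFin n f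
sumFin-*ˡ n k f rewrite sumFin≡sum n f | sumFin≡sum n (λ i → k * f i) = sym (*-distribˡ-sum k f)

sumFin-comm : ∀ n m (f : Fin n → Fin m → ℕ) →
  sumFin n (λ i → sumFin m (f i)) ≡ sumFin m (λ j → sumFin n (λ i → f i j))
sumFin-comm n m f = begin
  sumFin n (λ i → sumFin m (f i))        ≡⟨ sumFin-cong n (λ i → sumFin≡sum m (f i)) ⟩
  sumFin n (λ i → sum (f i))             ≡⟨ sumFin≡sum n _ ⟩
  sum (λ i → sum (f i))                  ≡⟨ ∑-comm f ⟩
  sum (λ j → sum (λ i → f i j))          ≡⟨ sumFin≡sum m _ ⟨
  sumFin m (λ j → sum (λ i → f i j))     ≡⟨ sumFin-cong m (λ j → sumFin≡sum n (λ i → f i j)) ⟨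
  sumFin m (λ j → sumFin n (λ i → f i j)) ∎
  where open ≡-Reasoning

sumFin-↑ : ∀ n n' (f : Fin (n + n') → ℕ) →
  sumFin (n + n') f ≡ sumFin n (λ i → f (i ↑ˡ n')) + sumFin n' (λ i → f (n ↑ʳ i))
sumFin-↑ zero    n' f = refl
sumFin-↑ (suc n) n' f =
  trans (cong (f F.zero +_) (sumFin-↑ n n' (λ i → f (F.suc i)))) (sym (+-assoc (f F.zero) _ _))

f≤sumFin : ∀ n (f : Fin n → ℕ) i → f i ≤ sumFin n f
f≤sumFin (suc n) f F.zero    = m≤m+n (f F.zero) _
f≤sumFin (suc n) f (F.suc i) = ≤-trans (f≤sumFin n (λ k → f (F.suc k)) i) (m≤n+m _ (f F.zero))

∃-true : ∀ m (f : Fin m → Bool) → 1 ≤ sumFin m (λ j → b2n (f j)) → ∃ λ j → f j ≡ true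
∃-true (suc m) f h with f F.zero in e
... | true  = F.zero , e
... | false with ∃-true m (λ j → f (F.suc j)) h
...   | j , fj = F.suc j , fj

transpose : ∀ {n m} → Matrix n m → Matrix m n
transpose M j i = M i j

ones≡sumFin-colSum : ∀ {n m} (M : Matrix n m) → ones M ≡ sumFin m (colSum M)
ones≡sumFin-colSum {n} {m} M = sumFin-comm n m (λ i j → b2n (M i j))

ones-transpose : ∀ {n m} (M : Matrix n m) → ones (transpose M) ≡ ones M
ones-transpose M = sym (ones≡sumFin-colSum M)

transpose-KTDS : ∀ {n m k} (M : Matrix n m) → IsKTDS k M → IsKTDS k (transpose M)
transpose-KTDS {k = k} M tds j i =
  subst (λ s → k ≤ s ∸ 2 * b2n (M i j)) (+-comm (rowSum M i) (colSum M j)) (tds i j)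

κ-zero : ∀ {n m k} {M : Matrix n m} → IsKTDS k M → ∀ {i j} → M i j ≡ false →
  k ≤ rowSum M i + colSum M j
κ-zero {k = k} {M} tds {i} {j} e = subst (λ b → k ≤ (rowSum M i + colSum M j) ∸ 2 * b2n b) e (tds i j)

κ-one : ∀ {n m k} {M : Matrix n m} → IsKTDS k M → ∀ {i j} → M i j ≡ true →
  2 + k ≤ rowSum M i + colSum M j
κ-one {n} {m} {k} {M} tds {i} {j} e =
  subst (_≤ rowSum M i + colSum M j) (+-comm k 2) (m≤o∸n⇒m+n≤o k 2≤sum k≤κ)
  where
  k≤κ : k ≤ (rowSum M i + colSum M j) ∸ 2
  k≤κ = subst (λ b → k ≤ (rowSum M i + colSum M j) ∸ 2 * b2n b) e (tds i j)
  2≤sum : 2 ≤ rowSum M i + colSum M j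
  2≤sum = +-mono-≤ (subst (λ b → b2n b ≤ rowSum M i) e (f≤sumFin m (λ j → b2n (M i j)) j))
                   (subst (λ b → b2n b ≤ colSum M j) e (f≤sumFin n (λ i → b2n (M i j)) i))

emptyRow-bound : ∀ {n m k} {M : Matrix n m} → IsKTDS k M → ∀ i → rowSum M i ≡ 0 → m * k ≤ ones M
emptyRow-bound {n} {m} {k} {M} tds i r≡0 = begin
  m * k                    ≡⟨ sumFin-const m k ⟨
  sumFin m (λ _ → k)       ≤⟨ sumFin-mono m k≤colSum ⟩
  sumFin m (colSum M)      ≡⟨ ones≡sumFin-colSum M ⟨
  ones M                   ∎
  where
  open ≤-Reasoning
  zeroEntry : ∀ j → M i j ≡ false
  zeroEntry j with M i j in e | f≤sumFin m (λ j → b2n (M i j)) j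
  ... | false | _   = refl
  ... | true  | 1≤r = contradiction (subst (1 ≤_) r≡0 1≤r) λ ()
  k≤colSum : ∀ j → k ≤ colSum M j
  k≤colSum j = subst (λ r → k ≤ r + colSum M j) r≡0 (κ-zero {M = M} tds (zeroEntry j))

[≡1] : ℕ → ℕ
[≡1] 1 = 1
[≡1] _ = 0

[≡2] : ℕ → ℕ
[≡2] 2 = 1
[≡2] _ = 0

[≥3] : ℕ → ℕ
[≥3] (suc (suc (suc _))) = 1
[≥3] _                   = 0

line-weight : ∀ r → 1 ≤ r → 2 * r + [≡1] r ≡ 3 + ([≡2] r + (r ∸ 3)) + r * [≥3] r
line-weight 1                   _ = refl
line-weight 2                   _ = refl
line-weight (suc (suc (suc k))) _ = identity k
  where
  identity : ∀ k → 2 * (3 + k) + 0 ≡ 3 + (0 + k) + (3 + k) * 1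
  identity = solve-∀

line-class : ∀ r → 1 ≤ r → 1 ≡ [≡1] r + [≡2] r + [≥3] r
line-class 1                   _ = refl
line-class 2                   _ = refl
line-class (suc (suc (suc k))) _ = refl

large-weight : ∀ r → r * [≥3] r ≡ [≥3] r * 3 + (r ∸ 3)
large-weight 0                   = refl
large-weight 1                   = refl
large-weight 2                   = refl
large-weight (suc (suc (suc k))) = identity k
  where
  identity : ∀ k → (3 + k) * 1 ≡ 1 * 3 + k
  identity = solve-∀

[≡1]≤r*[≡1] : ∀ r → [≡1] r ≤ r * [≡1] r
[≡1]≤r*[≡1] 0             = z≤n
[≡1]≤r*[≡1] 1             = ≤-refl
[≡1]≤r*[≡1] (suc (suc r)) = z≤n

[≡1]≤[≥3] : ∀ a b → 4 ≤ a + b → [≡1] a ≤ [≥3] b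
[≡1]≤[≥3] 0             b                   _ = z≤n
[≡1]≤[≥3] 1             (suc (suc (suc b))) _ = ≤-refl
[≡1]≤[≥3] 1             0                   (s≤s ())
[≡1]≤[≥3] 1             1                   (s≤s (s≤s ()))
[≡1]≤[≥3] 1             2                   (s≤s (s≤s (s≤s ())))
[≡1]≤[≥3] (suc (suc a)) b                   _ = z≤n

module LineSums {k : ℕ} (r : Fin k → ℕ) where

  singles : ℕ
  singles = sumFin k (λ i → [≡1] (r i))

  doubles : ℕ
  doubles = sumFin k (λ i → [≡2] (r i))

  larges : ℕ
  larges = sumFin k (λ i → [≥3] (r i))

  overflow : ℕ
  overflow = sumFin k (λ i → r i ∸ 3)

  largeMass : ℕ
  largeMass = sumFin k (λ i → r i * [≥3] (r i))

  weight : (∀ i → 1 ≤ r i) → 2 * sumFin k r + singles ≡ k * 3 + (doubles + overflow) + largeMass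
  weight r⁺ = begin
    2 * sumFin k r + singles
      ≡⟨ cong (_+ singles) (sumFin-*ˡ k 2 r) ⟨
    sumFin k (λ i → 2 * r i) + singles
      ≡⟨ sumFin-+ k _ _ ⟨
    sumFin k (λ i → 2 * r i + [≡1] (r i))
      ≡⟨ sumFin-cong k (λ i → line-weight (r i) (r⁺ i)) ⟩
    sumFin k (λ i → 3 + ([≡2] (r i) + (r i ∸ 3)) + r i * [≥3] (r i))
      ≡⟨ sumFin-+ k _ _ ⟩
    sumFin k (λ i → 3 + ([≡2] (r i) + (r i ∸ 3))) + largeMass
      ≡⟨ cong (_+ largeMass) (sumFin-+ k _ _) ⟩
    sumFin k (λ _ → 3) + sumFin k (λ i → [≡2] (r i) + (r i ∸ 3)) + largeMass
      ≡⟨ cong₂ (λ x y → x + y + largeMass) (sumFin-const k 3) (sumFin-+ k _ _) ⟩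
    k * 3 + (doubles + overflow) + largeMass
      ∎
    where open ≡-Reasoning

  count : (∀ i → 1 ≤ r i) → k ≡ singles + doubles + larges
  count r⁺ = begin
    k                                                      ≡⟨ *-identityʳ k ⟨
    k * 1                                                  ≡⟨ sumFin-const k 1 ⟨
    sumFin k (λ _ → 1)                                     ≡⟨ sumFin-cong k (λ i → line-class (r i) (r⁺ i)) ⟩
    sumFin k (λ i → [≡1] (r i) + [≡2] (r i) + [≥3] (r i))  ≡⟨ sumFin-+ k _ _ ⟩
    sumFin k (λ i → [≡1] (r i) + [≡2] (r i)) + larges      ≡⟨ cong (_+ larges) (sumFin-+ k _ _) ⟩
    singles + doubles + larges                             ∎
    where open ≡-Reasoning

  largeMass-split : largeMass ≡ larges * 3 + overflow
  largeMass-split = begin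
    largeMass                                             ≡⟨ sumFin-cong k (λ i → large-weight (r i)) ⟩
    sumFin k (λ i → [≥3] (r i) * 3 + (r i ∸ 3))           ≡⟨ sumFin-+ k _ _ ⟩
    sumFin k (λ i → [≥3] (r i) * 3) + overflow            ≡⟨ cong (_+ overflow) (sumFin-*ʳ k _ 3) ⟩
    larges * 3 + overflow                                 ∎
    where open ≡-Reasoning

-- At a one of a row with a single one, κ ≥ 2 forces its column to hold at least three ones.
singles≤largeMass : ∀ {n m} (M : Matrix n m) → IsKTDS 2 M →
  LineSums.singles (rowSum M) ≤ LineSums.largeMass (colSum M)
singles≤largeMass {n} {m} M tds = begin
  sumFin n (λ i → [≡1] (rowSum M i))
    ≤⟨ sumFin-mono n row-bound ⟩
  sumFin n (λ i → sumFin m (λ j → b2n (M i j) * [≥3] (colSum M j)))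
    ≡⟨ sumFin-comm n m _ ⟩
  sumFin m (λ j → sumFin n (λ i → b2n (M i j) * [≥3] (colSum M j)))
    ≡⟨ sumFin-cong m (λ j → sumFin-*ʳ n (λ i → b2n (M i j)) _) ⟩
  sumFin m (λ j → colSum M j * [≥3] (colSum M j))
    ∎
  where
  open ≤-Reasoning
  entry-bound : ∀ i j → b2n (M i j) * [≡1] (rowSum M i) ≤ b2n (M i j) * [≥3] (colSum M j)
  entry-bound i j with M i j in e
  ... | false = z≤n
  ... | true  = +-monoˡ-≤ 0 ([≡1]≤[≥3] _ _ (κ-one {M = M} tds e))
  row-bound : ∀ i → [≡1] (rowSum M i) ≤ sumFin m (λ j → b2n (M i j) * [≥3] (colSum M j))
  row-bound i = begin
    [≡1] (rowSum M i)                                     ≤⟨ [≡1]≤r*[≡1] (rowSum M i) ⟩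
    rowSum M i * [≡1] (rowSum M i)                        ≡⟨ sumFin-*ʳ m (λ j → b2n (M i j)) _ ⟨
    sumFin m (λ j → b2n (M i j) * [≡1] (rowSum M i))      ≤⟨ sumFin-mono m (entry-bound i) ⟩
    sumFin m (λ j → b2n (M i j) * [≥3] (colSum M j))      ∎

≤-+-tight : ∀ {a b c d} → a ≤ b → c ≤ d → a + c ≡ b + d → a ≡ b × c ≡ d
≤-+-tight {a} {b} {c} {d} a≤b c≤d eq = a≡b , +-cancelˡ-≡ a c d (trans eq (cong (_+ d) (sym a≡b)))
  where
  a≡b : a ≡ b
  a≡b = ≤-antisym a≤b (+-cancelʳ-≤ c b a (≤-trans (+-monoʳ-≤ b c≤d) (≤-reflexive (sym eq))))

-- N ones; E, F lines with one 1; P, Q slack; S, T ones in lines with at least three ones.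
module Balance {N n m E F P Q S T : ℕ}
  (rows : 2 * N + E ≡ n * 3 + P + S) (cols : 2 * N + F ≡ m * 3 + Q + T)
  (E≤T : E ≤ T) (F≤S : F ≤ S) where

  both : 4 * N + (E + F) ≡ (n + m) * 3 + (P + Q) + (S + T)
  both = begin
    4 * N + (E + F)                    ≡⟨ split N E F ⟩
    (2 * N + E) + (2 * N + F)          ≡⟨ cong₂ _+_ rows cols ⟩
    (n * 3 + P + S) + (m * 3 + Q + T)  ≡⟨ regroup n m P Q S T ⟩
    (n + m) * 3 + (P + Q) + (S + T)    ∎
    where
    open ≡-Reasoning
    split : ∀ N E F → 4 * N + (E + F) ≡ (2 * N + E) + (2 * N + F)
    split = solve-∀
    regroup : ∀ n m P Q S T → (n * 3 + P + S) + (m * 3 + Q + T) ≡ (n + m) * 3 + (P + Q) + (S + T)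
    regroup = solve-∀

  E+F≤S+T : E + F ≤ S + T
  E+F≤S+T = ≤-trans (+-mono-≤ E≤T F≤S) (≤-reflexive (+-comm T S))

  bound : (n + m) * 3 ≤ 4 * N
  bound = +-cancelʳ-≤ (E + F) _ _ (begin
    (n + m) * 3 + (E + F)              ≤⟨ +-monoʳ-≤ ((n + m) * 3) E+F≤S+T ⟩
    (n + m) * 3 + (S + T)              ≤⟨ +-monoˡ-≤ (S + T) (m≤m+n ((n + m) * 3) (P + Q)) ⟩
    (n + m) * 3 + (P + Q) + (S + T)    ≡⟨ both ⟨
    4 * N + (E + F)                    ∎)
    where open ≤-Reasoning

  tight : 4 * N ≡ (n + m) * 3 → P + Q ≡ 0 × E ≡ T × F ≡ S
  tight eq = P+Q≡0 , ≤-+-tight E≤T F≤S (trans E+F≡ (trans (cong (_+ (S + T)) P+Q≡0) (+-comm S T)))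
    where
    E+F≡ : E + F ≡ (P + Q) + (S + T)
    E+F≡ = +-cancelˡ-≡ ((n + m) * 3) _ _
             (trans (cong (_+ (E + F)) (sym eq)) (trans both (+-assoc ((n + m) * 3) (P + Q) (S + T))))
    P+Q≡0 : P + Q ≡ 0
    P+Q≡0 = n≤0⇒n≡0 (+-cancelʳ-≤ (S + T) (P + Q) 0 (subst (_≤ S + T) E+F≡ E+F≤S+T))

-- (n, m) is the size of a block-diagonal sum of a copies of J(3,1) and b copies of J(1,3).
Perfect : ℕ → ℕ → Set
Perfect n m = ∃[ a ] ∃[ b ] (n ≡ a * 3 + b × m ≡ b * 3 + a)

CountingBound : ℕ → ℕ → ℕ → Set
CountingBound n m N = (n + m) * 3 ≤ 4 * N × (4 * N ≡ (n + m) * 3 → Perfect n m)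

line-count-tight : ∀ {k s d l o} a → k ≡ s + d + l → s ≡ a * 3 + o → d ≡ 0 → o ≡ 0 → k ≡ a * 3 + l
line-count-tight {l = l} a refl refl refl refl = cong (_+ l) (trans (+-identityʳ (a * 3 + 0)) (+-identityʳ (a * 3)))

noEmptyLine-bound : ∀ {n m} (M : Matrix n m) → IsKTDS 2 M →
  (∀ i → 1 ≤ rowSum M i) → (∀ j → 1 ≤ colSum M j) → CountingBound n m (ones M)
noEmptyLine-bound {n} {m} M tds rows⁺ cols⁺ = B.bound , perfect
  where
  module R = LineSums (rowSum M)
  module C = LineSums (colSum M)
  cols-weight : 2 * ones M + C.singles ≡ m * 3 + (C.doubles + C.overflow) + C.largeMass
  cols-weight = subst (λ N → 2 * N + C.singles ≡ m * 3 + (C.doubles + C.overflow) + C.largeMass)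
                      (sym (ones≡sumFin-colSum M)) (C.weight cols⁺)
  module B = Balance {N = ones M} {n} {m} (R.weight rows⁺) cols-weight
                     (singles≤largeMass M tds) (singles≤largeMass (transpose M) (transpose-KTDS M tds))
  perfect : 4 * ones M ≡ (n + m) * 3 → Perfect n m
  perfect eq with B.tight eq
  ... | P+Q≡0 , rowSingles , colSingles =
    C.larges , R.larges ,
    line-count-tight C.larges (R.count rows⁺) (trans rowSingles C.largeMass-split)
                     (m+n≡0⇒m≡0 R.doubles P≡0) (m+n≡0⇒n≡0 C.doubles Q≡0) ,
    line-count-tight R.larges (C.count cols⁺) (trans colSingles R.largeMass-split)
                     (m+n≡0⇒m≡0 C.doubles Q≡0) (m+n≡0⇒n≡0 R.doubles P≡0)
    where
    P≡0 : R.doubles + R.overflow ≡ 0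
    P≡0 = m+n≡0⇒m≡0 (R.doubles + R.overflow) P+Q≡0
    Q≡0 : C.doubles + C.overflow ≡ 0
    Q≡0 = m+n≡0⇒n≡0 (R.doubles + R.overflow) P+Q≡0

ones-lowerBound : ∀ {n m} (M : Matrix n m) → IsKTDS 2 M →
  m * 2 ≤ ones M ⊎ n * 2 ≤ ones M ⊎ CountingBound n m (ones M)
ones-lowerBound {n} {m} M tds with any? (λ i → rowSum M i ≟ 0) | any? (λ j → colSum M j ≟ 0)
... | yes (i , r≡0) | _ = inj₁ (emptyRow-bound tds i r≡0)
... | no _ | yes (j , c≡0) =
  inj₂ (inj₁ (subst (n * 2 ≤_) (ones-transpose M) (emptyRow-bound (transpose-KTDS M tds) j c≡0)))
... | no ∄r | no ∄c = inj₂ (inj₂ (noEmptyLine-bound M tds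
  (λ i → n≢0⇒n>0 (λ r≡0 → ∄r (i , r≡0))) (λ j → n≢0⇒n>0 (λ c≡0 → ∄c (j , c≡0)))))

zeros : ∀ a b → Matrix a b
zeros _ _ _ _ = false

select : ∀ {n m n' m'} → Matrix n m → Matrix n' m' → Fin n ⊎ Fin n' → Fin m ⊎ Fin m' → Bool
select A B (inj₁ i) (inj₁ j) = A i j
select A B (inj₂ i) (inj₂ j) = B i j
select A B _        _        = false

infixl 6 _⊕_
_⊕_ : ∀ {n m n' m'} → Matrix n m → Matrix n' m' → Matrix (n + n') (m + m')
_⊕_ {n} {m} A B i j = select A B (F.splitAt n i) (F.splitAt m j)

data SplitView (n n' : ℕ) : Fin (n + n') → Set where
  ↑ˡ-view : (i : Fin n)  → SplitView n n' (i ↑ˡ n')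
  ↑ʳ-view : (i : Fin n') → SplitView n n' (n ↑ʳ i)

splitView : ∀ n {n'} (i : Fin (n + n')) → SplitView n n' i
splitView zero    i         = ↑ʳ-view i
splitView (suc n) F.zero    = ↑ˡ-view F.zero
splitView (suc n) (F.suc i) with splitView n i
... | ↑ˡ-view k = ↑ˡ-view (F.suc k)
... | ↑ʳ-view k = ↑ʳ-view k

sumFin-↑ˡ-only : ∀ n n' {f : Fin (n + n') → ℕ} {g : Fin n → ℕ} →
  (∀ i → f (i ↑ˡ n') ≡ g i) → (∀ i → f (n ↑ʳ i) ≡ 0) → sumFin (n + n') f ≡ sumFin n g
sumFin-↑ˡ-only n n' f≡g f≡0 =
  trans (sumFin-↑ n n' _) (trans (cong₂ _+_ (sumFin-cong n f≡g) (trans (sumFin-cong n' f≡0) (sumFin-zero n')))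
                                 (+-identityʳ _))

sumFin-↑ʳ-only : ∀ n n' {f : Fin (n + n') → ℕ} {g : Fin n' → ℕ} →
  (∀ i → f (i ↑ˡ n') ≡ 0) → (∀ i → f (n ↑ʳ i) ≡ g i) → sumFin (n + n') f ≡ sumFin n' g
sumFin-↑ʳ-only n n' f≡0 f≡g =
  trans (sumFin-↑ n n' _) (cong₂ _+_ (trans (sumFin-cong n f≡0) (sumFin-zero n)) (sumFin-cong n' f≡g))

κ-cong : ∀ {n m} (M : Matrix n m) {i j r c b} →
  rowSum M i ≡ r → colSum M j ≡ c → M i j ≡ b → κ M i j ≡ (r + c) ∸ 2 * b2n b
κ-cong M refl refl refl = refl

between-+⁺ : ∀ o {a b c} → StrictlyBetween a b c → StrictlyBetween (o + a) (o + b) (o + c)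
between-+⁺ o (inj₁ (a<b , b<c)) = inj₁ (+-monoʳ-< o a<b , +-monoʳ-< o b<c)
between-+⁺ o (inj₂ (c<b , b<a)) = inj₂ (+-monoʳ-< o c<b , +-monoʳ-< o b<a)

between-+⁻ : ∀ o {a b c} → StrictlyBetween (o + a) (o + b) (o + c) → StrictlyBetween a b c
between-+⁻ o (inj₁ (a<b , b<c)) = inj₁ (+-cancelˡ-< o _ _ a<b , +-cancelˡ-< o _ _ b<c)
between-+⁻ o (inj₂ (c<b , b<a)) = inj₂ (+-cancelˡ-< o _ _ c<b , +-cancelˡ-< o _ _ b<a)

module Translation {k K : ℕ} (f : Fin k → Fin K) (o : ℕ) (toℕ-f : ∀ x → toℕ (f x) ≡ o + toℕ x) where

  injective : ∀ {x y} → f x ≡ f y → x ≡ y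
  injective {x} {y} eq = toℕ-injective (+-cancelˡ-≡ o _ _ (trans (sym (toℕ-f x)) (trans (cong toℕ eq) (toℕ-f y))))

  between⁺ : ∀ {x y z} → StrictlyBetween (toℕ x) (toℕ y) (toℕ z) →
    StrictlyBetween (toℕ (f x)) (toℕ (f y)) (toℕ (f z))
  between⁺ {x} {y} {z} sb rewrite toℕ-f x | toℕ-f y | toℕ-f z = between-+⁺ o sb

  between⁻ : ∀ {x y z} → StrictlyBetween (toℕ (f x)) (toℕ (f y)) (toℕ (f z)) →
    StrictlyBetween (toℕ x) (toℕ y) (toℕ z)
  between⁻ {x} {y} {z} sb rewrite toℕ-f x | toℕ-f y | toℕ-f z = between-+⁻ o sb

record Embedding {n m N K : ℕ} (A : Matrix n m) (M : Matrix N K) : Set where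
  field
    row : Fin n → Fin N
    col : Fin m → Fin K
    row-offset col-offset : ℕ
    toℕ-row : ∀ i → toℕ (row i) ≡ row-offset + toℕ i
    toℕ-col : ∀ j → toℕ (col j) ≡ col-offset + toℕ j
    entry : ∀ i j → M (row i) (col j) ≡ A i j
    row-closed : ∀ i c → M (row i) c ≡ true → ∃ λ j → col j ≡ c
    col-closed : ∀ j r → M r (col j) ≡ true → ∃ λ i → row i ≡ r

module EmbeddingProperties {n m N K : ℕ} {A : Matrix n m} {M : Matrix N K} (e : Embedding A M) where
  open Embedding e
  private
    module Row = Translation row row-offset toℕ-row
    module Col = Translation col col-offset toℕ-col

  embed : Pos n m → Pos N K
  embed (i , j) = row i , col j

  adj⁺ : ∀ {p q} → Adj A p q → Adj M (embed p) (embed q)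
  adj⁺ (sameRow {i} {j} {j'} a a' j≢j' gap) =
    sameRow (trans (entry i j) a) (trans (entry i j') a') (j≢j' ∘ Col.injective) gap'
    where
    gap' : ∀ c → StrictlyBetween (toℕ (col j)) (toℕ c) (toℕ (col j')) → M (row i) c ≡ false
    gap' c sb with M (row i) c in mc
    ... | false = refl
    ... | true with row-closed i c mc
    ...   | j'' , refl = trans (sym mc) (trans (entry i j'') (gap j'' (Col.between⁻ sb)))
  adj⁺ (sameCol {i} {i'} {j} a a' i≢i' gap) =
    sameCol (trans (entry i j) a) (trans (entry i' j) a') (i≢i' ∘ Row.injective) gap'
    where
    gap' : ∀ r → StrictlyBetween (toℕ (row i)) (toℕ r) (toℕ (row i')) → M r (col j) ≡ false
    gap' r sb with M r (col j) in mr
    ... | false = refl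
    ... | true with col-closed j r mr
    ...   | i'' , refl = trans (sym mr) (trans (entry i'' j) (gap i'' (Row.between⁻ sb)))

  adj⁻ : ∀ {i j q} → Adj M (row i , col j) q → ∃ λ q' → q ≡ embed q' × Adj A (i , j) q'
  adj⁻ {i} {j} (sameRow {j' = c} m m' ne gap) with row-closed i c m'
  ... | j' , refl = (i , j') , refl ,
    sameRow (trans (sym (entry i j)) m) (trans (sym (entry i j')) m') (ne ∘ cong col)
            (λ j'' sb → trans (sym (entry i j'')) (gap (col j'') (Col.between⁺ sb)))
  adj⁻ {i} {j} (sameCol {i' = r} m m' ne gap) with col-closed j r m'
  ... | i' , refl = (i' , j) , refl ,
    sameCol (trans (sym (entry i j)) m) (trans (sym (entry i' j)) m') (ne ∘ cong row)
            (λ i'' sb → trans (sym (entry i'' j)) (gap (row i'') (Row.between⁺ sb)))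

  reach⁺ : ∀ {p q} → Reach A p q → Reach M (embed p) (embed q)
  reach⁺ = gmap embed adj⁺

  reach⁻ : ∀ {i j q} → Reach M (row i , col j) q → ∃ λ q' → q ≡ embed q' × Reach A (i , j) q'
  reach⁻ ε = _ , refl , ε
  reach⁻ (step ◅ steps) with adj⁻ step
  ... | (i' , j') , refl , a with reach⁻ steps
  ...   | q , q≡ , path = q , q≡ , a ◅ path

  component⁺ : ∀ i j → ComponentAllowed A (i , j) → ComponentAllowed M (row i , col j)
  component⁺ i j (x , y , shape , ρ , σ , ρ-inj , σ-inj , rows , cols , entries) =
    x , y , shape , row ∘ ρ , col ∘ σ ,
    (λ eq → ρ-inj (Row.injective eq)) , (λ eq → σ-inj (Col.injective eq)) ,
    (λ r → mk⇔ (rows-to r) rows-from) , (λ c → mk⇔ (cols-to c) cols-from) ,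
    (λ a b → trans (entry (ρ a) (σ b)) (entries a b))
    where
    rows-to : ∀ r → CompRows M (row i , col j) r → ∃[ a ] (row (ρ a) ≡ r)
    rows-to r (c , mrc , path) with reach⁻ path
    ... | (i' , j') , refl , path' with Equivalence.to (rows i') (j' , trans (sym (entry i' j')) mrc , path')
    ...   | a , ρa≡i' = a , cong row ρa≡i'
    rows-from : ∀ {r} → ∃[ a ] (row (ρ a) ≡ r) → CompRows M (row i , col j) r
    rows-from (a , refl) with Equivalence.from (rows (ρ a)) (a , refl)
    ... | c , a≡true , path = col c , trans (entry (ρ a) c) a≡true , reach⁺ path
    cols-to : ∀ c → CompCols M (row i , col j) c → ∃[ b ] (col (σ b) ≡ c)
    cols-to c (r , mrc , path) with reach⁻ path
    ... | (i' , j') , refl , path' with Equivalence.to (cols j') (i' , trans (sym (entry i' j')) mrc , path')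
    ...   | b , σb≡j' = b , cong col σb≡j'
    cols-from : ∀ {c} → ∃[ b ] (col (σ b) ≡ c) → CompCols M (row i , col j) c
    cols-from (b , refl) with Equivalence.from (cols (σ b)) (b , refl)
    ... | r , a≡true , path = row r , trans (entry r (σ b)) a≡true , reach⁺ path

module DirectSum {n m n' m'} (A : Matrix n m) (B : Matrix n' m') where

  ⊕-↑ˡ↑ˡ : ∀ i j → (A ⊕ B) (i ↑ˡ n') (j ↑ˡ m') ≡ A i j
  ⊕-↑ˡ↑ˡ i j rewrite splitAt-↑ˡ n i n' | splitAt-↑ˡ m j m' = refl

  ⊕-↑ˡ↑ʳ : ∀ i j → (A ⊕ B) (i ↑ˡ n') (m ↑ʳ j) ≡ false
  ⊕-↑ˡ↑ʳ i j rewrite splitAt-↑ˡ n i n' | splitAt-↑ʳ m m' j = refl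

  ⊕-↑ʳ↑ˡ : ∀ i j → (A ⊕ B) (n ↑ʳ i) (j ↑ˡ m') ≡ false
  ⊕-↑ʳ↑ˡ i j rewrite splitAt-↑ʳ n n' i | splitAt-↑ˡ m j m' = refl

  ⊕-↑ʳ↑ʳ : ∀ i j → (A ⊕ B) (n ↑ʳ i) (m ↑ʳ j) ≡ B i j
  ⊕-↑ʳ↑ʳ i j rewrite splitAt-↑ʳ n n' i | splitAt-↑ʳ m m' j = refl

  rowSum-↑ˡ : ∀ i → rowSum (A ⊕ B) (i ↑ˡ n') ≡ rowSum A i
  rowSum-↑ˡ i = sumFin-↑ˡ-only m m' (cong b2n ∘ ⊕-↑ˡ↑ˡ i) (cong b2n ∘ ⊕-↑ˡ↑ʳ i)

  rowSum-↑ʳ : ∀ i → rowSum (A ⊕ B) (n ↑ʳ i) ≡ rowSum B i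
  rowSum-↑ʳ i = sumFin-↑ʳ-only m m' (cong b2n ∘ ⊕-↑ʳ↑ˡ i) (cong b2n ∘ ⊕-↑ʳ↑ʳ i)

  colSum-↑ˡ : ∀ j → colSum (A ⊕ B) (j ↑ˡ m') ≡ colSum A j
  colSum-↑ˡ j = sumFin-↑ˡ-only n n' (λ i → cong b2n (⊕-↑ˡ↑ˡ i j)) (λ i → cong b2n (⊕-↑ʳ↑ˡ i j))

  colSum-↑ʳ : ∀ j → colSum (A ⊕ B) (m ↑ʳ j) ≡ colSum B j
  colSum-↑ʳ j = sumFin-↑ʳ-only n n' (λ i → cong b2n (⊕-↑ˡ↑ʳ i j)) (λ i → cong b2n (⊕-↑ʳ↑ʳ i j))

  ones-⊕ : ones (A ⊕ B) ≡ ones A + ones B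
  ones-⊕ = trans (sumFin-↑ n n' _) (cong₂ _+_ (sumFin-cong n rowSum-↑ˡ) (sumFin-cong n' rowSum-↑ʳ))

  KTDS-⊕ : ∀ {k} → IsKTDS k A → IsKTDS k B →
    (∀ i j → k ≤ rowSum A i + colSum B j) → (∀ i j → k ≤ rowSum B i + colSum A j) → IsKTDS k (A ⊕ B)
  KTDS-⊕ {k} tdsA tdsB AB BA i j with splitView n i | splitView m j
  ... | ↑ˡ-view i | ↑ˡ-view j = subst (k ≤_) (sym (κ-cong (A ⊕ B) (rowSum-↑ˡ i) (colSum-↑ˡ j) (⊕-↑ˡ↑ˡ i j))) (tdsA i j)
  ... | ↑ˡ-view i | ↑ʳ-view j = subst (k ≤_) (sym (κ-cong (A ⊕ B) (rowSum-↑ˡ i) (colSum-↑ʳ j) (⊕-↑ˡ↑ʳ i j))) (AB i j)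
  ... | ↑ʳ-view i | ↑ˡ-view j = subst (k ≤_) (sym (κ-cong (A ⊕ B) (rowSum-↑ʳ i) (colSum-↑ˡ j) (⊕-↑ʳ↑ˡ i j))) (BA i j)
  ... | ↑ʳ-view i | ↑ʳ-view j = subst (k ≤_) (sym (κ-cong (A ⊕ B) (rowSum-↑ʳ i) (colSum-↑ʳ j) (⊕-↑ʳ↑ʳ i j))) (tdsB i j)

  left : Embedding A (A ⊕ B)
  left = record
    { row = _↑ˡ n' ; col = _↑ˡ m' ; row-offset = 0 ; col-offset = 0
    ; toℕ-row = λ i → toℕ-↑ˡ i n' ; toℕ-col = λ j → toℕ-↑ˡ j m'
    ; entry = ⊕-↑ˡ↑ˡ ; row-closed = row-closed ; col-closed = col-closed }
    where
    row-closed : ∀ i c → (A ⊕ B) (i ↑ˡ n') c ≡ true → ∃ λ j → j ↑ˡ m' ≡ c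
    row-closed i c e with splitView m c
    ... | ↑ˡ-view j = j , refl
    ... | ↑ʳ-view j = contradiction (trans (sym e) (⊕-↑ˡ↑ʳ i j)) λ ()
    col-closed : ∀ j r → (A ⊕ B) r (j ↑ˡ m') ≡ true → ∃ λ i → i ↑ˡ n' ≡ r
    col-closed j r e with splitView n r
    ... | ↑ˡ-view i = i , refl
    ... | ↑ʳ-view i = contradiction (trans (sym e) (⊕-↑ʳ↑ˡ i j)) λ ()

  right : Embedding B (A ⊕ B)
  right = record
    { row = n ↑ʳ_ ; col = m ↑ʳ_ ; row-offset = n ; col-offset = m
    ; toℕ-row = toℕ-↑ʳ n ; toℕ-col = toℕ-↑ʳ m
    ; entry = ⊕-↑ʳ↑ʳ ; row-closed = row-closed ; col-closed = col-closed }
    where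
    row-closed : ∀ i c → (A ⊕ B) (n ↑ʳ i) c ≡ true → ∃ λ j → m ↑ʳ j ≡ c
    row-closed i c e with splitView m c
    ... | ↑ˡ-view j = contradiction (trans (sym e) (⊕-↑ʳ↑ˡ i j)) λ ()
    ... | ↑ʳ-view j = j , refl
    col-closed : ∀ j r → (A ⊕ B) r (m ↑ʳ j) ≡ true → ∃ λ i → n ↑ʳ i ≡ r
    col-closed j r e with splitView n r
    ... | ↑ˡ-view i = contradiction (trans (sym e) (⊕-↑ˡ↑ʳ i j)) λ ()
    ... | ↑ʳ-view i = i , refl

  allowed-⊕ : AllComponentsAllowed A → AllComponentsAllowed B → AllComponentsAllowed (A ⊕ B)
  allowed-⊕ okA okB i j e with splitView n i | splitView m j
  ... | ↑ˡ-view i | ↑ˡ-view j = EmbeddingProperties.component⁺ left i j (okA i j (trans (sym (⊕-↑ˡ↑ˡ i j)) e))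
  ... | ↑ˡ-view i | ↑ʳ-view j = contradiction (trans (sym e) (⊕-↑ˡ↑ʳ i j)) λ ()
  ... | ↑ʳ-view i | ↑ˡ-view j = contradiction (trans (sym e) (⊕-↑ʳ↑ˡ i j)) λ ()
  ... | ↑ʳ-view i | ↑ʳ-view j = EmbeddingProperties.component⁺ right i j (okB i j (trans (sym (⊕-↑ʳ↑ʳ i j)) e))

rowSum-J : ∀ x y i → rowSum (J x y) i ≡ y
rowSum-J x y i = trans (sumFin-const y 1) (*-identityʳ y)

colSum-J : ∀ x y j → colSum (J x y) j ≡ x
colSum-J x y j = trans (sumFin-const x 1) (*-identityʳ x)

ones-J : ∀ x y → ones (J x y) ≡ x * y
ones-J x y = trans (sumFin-cong x (rowSum-J x y)) (sumFin-const x y)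

KTDS-J : ∀ {k} x y → 2 + k ≤ x + y → IsKTDS k (J x y)
KTDS-J {k} x y h i j rewrite rowSum-J x y i | colSum-J x y j =
  m+n≤o⇒m≤o∸n k (subst₂ _≤_ (+-comm 2 k) (+-comm x y) h)

¬between-suc : ∀ {t b} → ¬ StrictlyBetween t b (suc t)
¬between-suc (inj₁ (t<b , b<1+t)) = <⇒≱ t<b (≤-pred b<1+t)
¬between-suc {t} (inj₂ (1+t<b , b<t)) = <-asym 1+t<b (<-trans b<t (n<1+n t))

Adj-sym : ∀ {n m} {M : Matrix n m} {p q} → Adj M p q → Adj M q p
Adj-sym (sameRow a a' ne gap) = sameRow a' a (ne ∘ sym) (λ j sb → gap j (⊎-swap sb))
Adj-sym (sameCol a a' ne gap) = sameCol a' a (ne ∘ sym) (λ i sb → gap i (⊎-swap sb))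

inject₁≢suc : ∀ {k} (j : Fin k) → F.inject₁ j ≢ F.suc j
inject₁≢suc j eq = 1+n≢n (sym (trans (sym (toℕ-inject₁ j)) (cong toℕ eq)))

J-row-step : ∀ {x y} i (j : Fin y) → Adj (J x (suc y)) (i , F.inject₁ j) (i , F.suc j)
J-row-step i j = sameRow refl refl (inject₁≢suc j)
  (λ c sb → ⊥-elim (¬between-suc (subst (λ t → StrictlyBetween t (toℕ c) (suc (toℕ j))) (toℕ-inject₁ j) sb)))

J-col-step : ∀ {x y} (i : Fin x) j → Adj (J (suc x) y) (F.inject₁ i , j) (F.suc i , j)
J-col-step i j = sameCol refl refl (inject₁≢suc i)
  (λ r sb → ⊥-elim (¬between-suc (subst (λ t → StrictlyBetween t (toℕ r) (suc (toℕ i))) (toℕ-inject₁ i) sb)))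

J-reach-from-corner : ∀ {x y} (p : Pos (suc x) (suc y)) → Reach (J (suc x) (suc y)) (F.zero , F.zero) p
J-reach-from-corner {x} {y} (i , j) = down i ◅◅ across i j
  where
  down : ∀ i → Reach (J (suc x) (suc y)) (F.zero , F.zero) (i , F.zero)
  down = <-weakInduction _ ε (λ i path → path ◅◅ (J-col-step i F.zero ◅ ε))
  across : ∀ i j → Reach (J (suc x) (suc y)) (i , F.zero) (i , j)
  across i = <-weakInduction _ ε (λ j path → path ◅◅ (J-row-step i j ◅ ε))

J-connected : ∀ {x y} (p q : Pos x y) → Reach (J x y) p q
J-connected {suc x} {suc y} p q = revApp Adj-sym (J-reach-from-corner p) (J-reach-from-corner q)

allowed-J : ∀ x y → AllowedShape x y → AllComponentsAllowed (J x y)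
allowed-J x y shape i j _ =
  x , y , shape , id , id , id , id ,
  (λ r → mk⇔ (λ _ → r , refl) (λ _ → j , refl , J-connected _ _)) ,
  (λ c → mk⇔ (λ _ → c , refl) (λ _ → i , refl , J-connected _ _)) ,
  (λ _ _ → refl)

AllowedShape-size : ∀ {x y} → AllowedShape x y → 1 ≤ x × 1 ≤ y × 4 ≤ x + y
AllowedShape-size (inj₁ (refl , 3≤x))               = ≤-trans (s≤s z≤n) 3≤x , ≤-refl , +-monoˡ-≤ 1 3≤x
AllowedShape-size (inj₂ (inj₁ (refl , 3≤y)))        = ≤-refl , ≤-trans (s≤s z≤n) 3≤y , s≤s 3≤y
AllowedShape-size (inj₂ (inj₂ (inj₁ (refl , 2≤x)))) = ≤-trans (s≤s z≤n) 2≤x , s≤s z≤n , +-monoˡ-≤ 2 2≤x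
AllowedShape-size (inj₂ (inj₂ (inj₂ (refl , 2≤y)))) = s≤s z≤n , ≤-trans (s≤s z≤n) 2≤y , s≤s (s≤s 2≤y)

record Tiling (n m c : ℕ) : Set where
  field
    matrix     : Matrix n m
    isTDS      : IsKTDS 2 matrix
    allowed    : AllComponentsAllowed matrix
    rowSum-pos : ∀ i → 1 ≤ rowSum matrix i
    colSum-pos : ∀ j → 1 ≤ colSum matrix j
    ones≡      : ones matrix ≡ c

J-tiling : ∀ x y → AllowedShape x y → Tiling x y (x * y)
J-tiling x y shape with AllowedShape-size shape
... | 1≤x , 1≤y , 4≤x+y = record
  { matrix = J x y ; isTDS = KTDS-J x y 4≤x+y ; allowed = allowed-J x y shape
  ; rowSum-pos = λ i → subst (1 ≤_) (sym (rowSum-J x y i)) 1≤y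
  ; colSum-pos = λ j → subst (1 ≤_) (sym (colSum-J x y j)) 1≤x
  ; ones≡ = ones-J x y }

infixl 6 _⊞_
_⊞_ : ∀ {n m c n' m' c'} → Tiling n m c → Tiling n' m' c' → Tiling (n + n') (m + m') (c + c')
_⊞_ {n} {m} X Y = record
  { matrix = X.matrix ⊕ Y.matrix
  ; isTDS = KTDS-⊕ X.isTDS Y.isTDS (λ i j → +-mono-≤ (X.rowSum-pos i) (Y.colSum-pos j))
                                   (λ i j → +-mono-≤ (Y.rowSum-pos i) (X.colSum-pos j))
  ; allowed = allowed-⊕ X.allowed Y.allowed
  ; rowSum-pos = rows⁺ ; colSum-pos = cols⁺
  ; ones≡ = trans ones-⊕ (cong₂ _+_ X.ones≡ Y.ones≡) }
  where
  module X = Tiling X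
  module Y = Tiling Y
  open DirectSum X.matrix Y.matrix
  rows⁺ : ∀ i → 1 ≤ rowSum (X.matrix ⊕ Y.matrix) i
  rows⁺ i with splitView n i
  ... | ↑ˡ-view i = subst (1 ≤_) (sym (rowSum-↑ˡ i)) (X.rowSum-pos i)
  ... | ↑ʳ-view i = subst (1 ≤_) (sym (rowSum-↑ʳ i)) (Y.rowSum-pos i)
  cols⁺ : ∀ j → 1 ≤ colSum (X.matrix ⊕ Y.matrix) j
  cols⁺ j with splitView m j
  ... | ↑ˡ-view j = subst (1 ≤_) (sym (colSum-↑ˡ j)) (X.colSum-pos j)
  ... | ↑ʳ-view j = subst (1 ≤_) (sym (colSum-↑ʳ j)) (Y.colSum-pos j)

InCone : ℕ → ℕ → Set
InCone n m = 3 * m + 4 ≤ 5 * n × 3 * n + 4 ≤ 5 * m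

-- c ≤ ⌈3(n + m)/4⌉, or one more when the counting bound cannot be attained: either way c is minimal.
NearOptimal : ℕ → ℕ → ℕ → Set
NearOptimal n m c = 4 * c ≤ (n + m) * 3 + 3 ⊎ (4 * c ≡ (n + m) * 3 + 4 × ¬ Perfect n m)

Construction : ℕ → ℕ → Set
Construction n m = ∃[ c ] (Tiling n m c × NearOptimal n m c)

InCone-swap : ∀ {n m} → InCone n m → InCone m n
InCone-swap = swap

Perfect-swap : ∀ {n m} → Perfect n m → Perfect m n
Perfect-swap (a , b , n≡ , m≡) = b , a , m≡ , n≡

¬9b+4≤5b : ∀ b → ¬ 3 * (b * 3 + 0) + 4 ≤ 5 * b
¬9b+4≤5b b h = m+1+n≰m (5 * b) (subst (_≤ 5 * b) (identity b) h)
  where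
  identity : ∀ b → 3 * (b * 3 + 0) + 4 ≡ 5 * b + suc (4 * b + 3)
  identity = solve-∀

Perfect-31⁻ : ∀ {n m} → InCone (n + 3) (m + 1) → Perfect (n + 3) (m + 1) → Perfect n m
Perfect-31⁻ {n} {m} (cone , _) (zero , b , n+3≡b , m+1≡3b) =
  ⊥-elim (¬9b+4≤5b b (subst₂ (λ u v → 3 * v + 4 ≤ 5 * u) n+3≡b m+1≡3b cone))
Perfect-31⁻ {n} {m} _ (suc a , b , n+3≡ , m+1≡) =
  a , b , +-cancelʳ-≡ 3 n (a * 3 + b) (trans n+3≡ (rows a b)) ,
          +-cancelʳ-≡ 1 m (b * 3 + a) (trans m+1≡ (cols a b))
  where
  rows : ∀ a b → suc a * 3 + b ≡ a * 3 + b + 3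
  rows = solve-∀
  cols : ∀ a b → b * 3 + suc a ≡ b * 3 + a + 1
  cols = solve-∀

Perfect-13⁻ : ∀ {n m} → InCone (n + 1) (m + 3) → Perfect (n + 1) (m + 3) → Perfect n m
Perfect-13⁻ {n} {m} cone = Perfect-swap ∘ Perfect-31⁻ {m} {n} (InCone-swap {n + 1} {m + 3} cone) ∘ Perfect-swap

nearOptimal-step : ∀ {n m n' m' c} → n' + m' ≡ n + m + 4 → (¬ Perfect n m → ¬ Perfect n' m') →
  NearOptimal n m c → NearOptimal n' m' (c + 3)
nearOptimal-step {n} {m} {n'} {m'} {c} size ¬perfect⇒ = λ where
    (inj₁ h) → inj₁ (subst₂ _≤_ (sym (grow c)) (sym (shift 3)) (+-monoˡ-≤ 12 h))
    (inj₂ (eq , ¬perfect)) → inj₂ (trans (grow c) (trans (cong (_+ 12) eq) (sym (shift 4))) , ¬perfect⇒ ¬perfect)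
  where
  grow : ∀ c → 4 * (c + 3) ≡ 4 * c + 12
  grow = solve-∀
  shift : ∀ x → (n' + m') * 3 + x ≡ (n + m) * 3 + x + 12
  shift x = trans (cong (λ s → s * 3 + x) size) (identity (n + m) x)
    where
    identity : ∀ s x → (s + 4) * 3 + x ≡ s * 3 + x + 12
    identity = solve-∀

vertical : ∀ x → 3 ≤ x → Tiling x 1 (x * 1)
vertical x 3≤x = J-tiling x 1 (inj₁ (refl , 3≤x))

horizontal : ∀ y → 3 ≤ y → Tiling 1 y (1 * y)
horizontal y 3≤y = J-tiling 1 y (inj₂ (inj₁ (refl , 3≤y)))

add-31 : ∀ {n m} → InCone (n + 3) (m + 1) → Construction n m → Construction (n + 3) (m + 1)
add-31 {n} {m} cone (c , X , near) =
  c + 3 , X ⊞ vertical 3 ≤-refl , nearOptimal-step {c = c} (size n m) (λ ¬p → ¬p ∘ Perfect-31⁻ cone) near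
  where
  size : ∀ n m → n + 3 + (m + 1) ≡ n + m + 4
  size = solve-∀

add-13 : ∀ {n m} → InCone (n + 1) (m + 3) → Construction n m → Construction (n + 1) (m + 3)
add-13 {n} {m} cone (c , X , near) =
  c + 3 , X ⊞ horizontal 3 ≤-refl , nearOptimal-step {c = c} (size n m) (λ ¬p → ¬p ∘ Perfect-13⁻ cone) near
  where
  size : ∀ n m → n + 1 + (m + 3) ≡ n + m + 4
  size = solve-∀

≤⇒∃+ : ∀ {k n} → k ≤ n → ∃ λ n' → n ≡ n' + k
≤⇒∃+ {k} {n} k≤n = n ∸ k , sym (m∸n+n≡m k≤n)

far-31-size : ∀ {n m} → InCone n m → 3 * m + 16 ≤ 5 * n → 3 ≤ n × 1 ≤ m
far-31-size {n} {m} (_ , n-side) far =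
  *-cancelˡ-< 5 2 n (≤-trans (≤ᵇ⇒≤ 11 16 _) (≤-trans (m≤n+m 16 (3 * m)) far)) ,
  *-cancelˡ-< 5 0 m (≤-trans (s≤s z≤n) (≤-trans (m≤n+m 4 (3 * n)) n-side))

shrink-31 : ∀ {n m} → InCone (n + 3) (m + 1) → 3 * (m + 1) + 16 ≤ 5 * (n + 3) → InCone n m
shrink-31 {n} {m} (_ , n-side) far = m-side' , n-side'
  where
  m-side' : 3 * m + 4 ≤ 5 * n
  m-side' = +-cancelʳ-≤ 15 (3 * m + 4) (5 * n) (subst₂ _≤_ (e₁ m) (e₂ n) far)
    where
    e₁ : ∀ m → 3 * (m + 1) + 16 ≡ 3 * m + 4 + 15
    e₁ = solve-∀
    e₂ : ∀ n → 5 * (n + 3) ≡ 5 * n + 15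
    e₂ = solve-∀
  n-side' : 3 * n + 4 ≤ 5 * m
  n-side' = m+n≤o⇒m≤o (3 * n + 4) (+-cancelʳ-≤ 5 (3 * n + 4 + 4) (5 * m) (subst₂ _≤_ (e₁ n) (e₂ m) n-side))
    where
    e₁ : ∀ n → 3 * (n + 3) + 4 ≡ 3 * n + 4 + 4 + 5
    e₁ = solve-∀
    e₂ : ∀ m → 5 * (m + 1) ≡ 5 * m + 5
    e₂ = solve-∀

-- At (n, m) = (3, 3) the cone inequality is a false closed one, refuted by evaluating ≤ᵇ.
¬33-31 : ∀ {n m} → InCone (n + 3) (m + 1) → ¬ (n ≡ 3 × m ≡ 3)
¬33-31 (_ , n-side) (refl , refl) = ≤⇒≤ᵇ n-side

far-13-size : ∀ {n m} → InCone n m → 3 * n + 16 ≤ 5 * m → 1 ≤ n × 3 ≤ m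
far-13-size {n} {m} cone far = swap (far-31-size {m} {n} (InCone-swap {n} {m} cone) far)

shrink-13 : ∀ {n m} → InCone (n + 1) (m + 3) → 3 * (n + 1) + 16 ≤ 5 * (m + 3) → InCone n m
shrink-13 {n} {m} cone far = InCone-swap {m} {n} (shrink-31 {m} {n} (InCone-swap {n + 1} {m + 3} cone) far)

¬33-13 : ∀ {n m} → InCone (n + 1) (m + 3) → ¬ (n ≡ 3 × m ≡ 3)
¬33-13 (m-side , _) (refl , refl) = ≤⇒≤ᵇ m-side

Near : ℕ → ℕ → Set
Near n m = 5 * n < 3 * m + 16 × 5 * m < 3 * n + 16

Near⇒<8 : ∀ {n m} → Near n m → n < 8
Near⇒<8 {n} {m} (n-side , m-side) = *-cancelˡ-< 16 n 8 (+-cancelʳ-< (9 * n) (16 * n) (16 * 8) (begin-strict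
  16 * n + 9 * n          ≡⟨ e₁ n ⟩
  5 * (5 * n)             <⟨ *-monoʳ-< 5 n-side ⟩
  5 * (3 * m + 16)        ≡⟨ e₂ m ⟩
  3 * (5 * m) + 80        <⟨ +-monoˡ-< 80 (*-monoʳ-< 3 m-side) ⟩
  3 * (3 * n + 16) + 80   ≡⟨ e₃ n ⟩
  16 * 8 + 9 * n          ∎))
  where
  open ≤-Reasoning
  e₁ : ∀ n → 16 * n + 9 * n ≡ 5 * (5 * n)
  e₁ = solve-∀
  e₂ : ∀ m → 5 * (3 * m + 16) ≡ 3 * (5 * m) + 80
  e₂ = solve-∀
  e₃ : ∀ n → 3 * (3 * n + 16) + 80 ≡ 16 * 8 + 9 * n
  e₃ = solve-∀

¬Perfect-2-2 : ¬ Perfect 2 2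
¬Perfect-2-2 (0             , .2 , refl , ())
¬Perfect-2-2 (1             , _  , ()   , _)
¬Perfect-2-2 (suc (suc _)   , _  , ()   , _)

¬Perfect-6-6 : ¬ Perfect 6 6
¬Perfect-6-6 (0                   , .6 , refl , ())
¬Perfect-6-6 (1                   , .3 , refl , ())
¬Perfect-6-6 (2                   , .0 , refl , ())
¬Perfect-6-6 (suc (suc (suc _))   , _  , ()   , _)

-- The cone points from which neither step stays in the cone, except (3,3).
baseCases : ∀ n m → Maybe (Construction n m)
baseCases 2 2 = just (4  , J-tiling 2 2 (inj₂ (inj₂ (inj₁ (refl , ≤-refl)))) , inj₂ (refl , ¬Perfect-2-2))
baseCases 4 4 = just (6  , vertical 3 ≤-refl ⊞ horizontal 3 ≤-refl , inj₁ (≤ᵇ⇒≤ _ _ _))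
baseCases 4 5 = just (7  , vertical 3 ≤-refl ⊞ horizontal 4 (≤ᵇ⇒≤ 3 4 _) , inj₁ (≤ᵇ⇒≤ _ _ _))
baseCases 5 4 = just (7  , vertical 4 (≤ᵇ⇒≤ 3 4 _) ⊞ horizontal 3 ≤-refl , inj₁ (≤ᵇ⇒≤ _ _ _))
baseCases 5 5 = just (8  , vertical 4 (≤ᵇ⇒≤ 3 4 _) ⊞ horizontal 4 (≤ᵇ⇒≤ 3 4 _) , inj₁ (≤ᵇ⇒≤ _ _ _))
baseCases 5 6 = just (9  , vertical 4 (≤ᵇ⇒≤ 3 4 _) ⊞ horizontal 5 (≤ᵇ⇒≤ 3 5 _) , inj₁ (≤ᵇ⇒≤ _ _ _))
baseCases 6 5 = just (9  , vertical 5 (≤ᵇ⇒≤ 3 5 _) ⊞ horizontal 4 (≤ᵇ⇒≤ 3 4 _) , inj₁ (≤ᵇ⇒≤ _ _ _))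
baseCases 6 6 = just (10 , vertical 5 (≤ᵇ⇒≤ 3 5 _) ⊞ horizontal 5 (≤ᵇ⇒≤ 3 5 _) , inj₂ (refl , ¬Perfect-6-6))
baseCases 7 7 = just (11 , vertical 3 ≤-refl ⊞ vertical 3 ≤-refl ⊞ horizontal 5 (≤ᵇ⇒≤ 3 5 _) , inj₁ (≤ᵇ⇒≤ _ _ _))
baseCases _ _ = nothing

BaseCase : ℕ → ℕ → Set
BaseCase n m = InCone n m × Near n m × ¬ (n ≡ 3 × m ≡ 3)

baseCase? : ∀ n m → Dec (BaseCase n m)
baseCase? n m = ((3 * m + 4 ≤? 5 * n) ×-dec (3 * n + 4 ≤? 5 * m))
          ×-dec ((5 * n <? 3 * m + 16) ×-dec (5 * m <? 3 * n + 16))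
          ×-dec ¬? ((n ≟ 3) ×-dec (m ≟ 3))

baseCases-complete : ∀ {n} → n < 8 → ∀ {m} → m < 8 → BaseCase n m → T (is-just (baseCases n m))
baseCases-complete =
  from-yes (allUpTo? (λ n → allUpTo? (λ m → baseCase? n m →-dec T? (is-just (baseCases n m))) 8) 8)

ConstructionsBelow : ℕ → Set
ConstructionsBelow n = ∀ {n'} → n' < n → ∀ m → InCone n' m → ¬ (n' ≡ 3 × m ≡ 3) → Construction n' m

step-31 : ∀ {n m} → ConstructionsBelow n → InCone n m → 3 * m + 16 ≤ 5 * n → 3 ≤ n × 1 ≤ m → Construction n m
step-31 rec cone far (3≤n , 1≤m) with ≤⇒∃+ 3≤n | ≤⇒∃+ 1≤m
... | n' , refl | m' , refl =
  add-31 {n'} {m'} cone (rec (m<m+n n' (s≤s z≤n)) m' (shrink-31 {n'} {m'} cone far) (¬33-31 {n'} {m'} cone))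

step-13 : ∀ {n m} → ConstructionsBelow n → InCone n m → 3 * n + 16 ≤ 5 * m → 1 ≤ n × 3 ≤ m → Construction n m
step-13 rec cone far (1≤n , 3≤m) with ≤⇒∃+ 1≤n | ≤⇒∃+ 3≤m
... | n' , refl | m' , refl =
  add-13 {n'} {m'} cone (rec (m<m+n n' (s≤s z≤n)) m' (shrink-13 {n'} {m'} cone far) (¬33-13 {n'} {m'} cone))

construct : ∀ n m → InCone n m → ¬ (n ≡ 3 × m ≡ 3) → Construction n m
construct = <-rec (λ n → ∀ m → InCone n m → ¬ (n ≡ 3 × m ≡ 3) → Construction n m) go
  where
  go : ∀ n → ConstructionsBelow n → ∀ m → InCone n m → ¬ (n ≡ 3 × m ≡ 3) → Construction n m
  go n rec m cone ≢33 with 3 * m + 16 ≤? 5 * n | 3 * n + 16 ≤? 5 * m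
  ... | yes far | _        = step-31 rec cone far (far-31-size {n} {m} cone far)
  ... | no _    | yes far  = step-13 rec cone far (far-13-size {n} {m} cone far)
  ... | no ¬far | no ¬far' =
    to-witness-T (baseCases n m)
      (baseCases-complete (Near⇒<8 {n} {m} near) (Near⇒<8 {m} {n} (swap near)) (cone , near , ≢33))
    where
    near : Near n m
    near = ≰⇒> ¬far , ≰⇒> ¬far'

4*m≤4*n+3⇒m≤n : ∀ c N → 4 * c ≤ 4 * N + 3 → c ≤ N
4*m≤4*n+3⇒m≤n c N h = ≤-pred (*-cancelˡ-< 4 c (suc N) (≤-<-trans h (≤-reflexive (sym (identity N)))))
  where
  identity : ∀ N → 4 * suc N ≡ suc (4 * N + 3)
  identity = solve-∀

singleRow-bound : ∀ {m k} (M : Matrix 1 m) → IsKTDS k M → 1 ≤ m → 1 ≤ k → suc k ≤ ones M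
singleRow-bound {suc m} {k} M tds _ 1≤k with ∃-true (suc m) (M F.zero) 1≤r
  where
  r≢0 : rowSum M F.zero ≢ 0
  r≢0 r≡0 = <⇒≱ (*-mono-≤ {1} {suc m} (s≤s z≤n) 1≤k)
                 (subst (suc m * k ≤_) (cong (_+ 0) r≡0) (emptyRow-bound {M = M} tds F.zero r≡0))
  1≤r : 1 ≤ rowSum M F.zero
  1≤r = n≢0⇒n>0 r≢0
... | j , e = subst (suc k ≤_) (sym (+-identityʳ _)) (≤-pred (subst (2 + k ≤_) (+-comm (rowSum M F.zero) 1)
  (subst (λ c → 2 + k ≤ rowSum M F.zero + c) (colSum≡1 e) (κ-one {M = M} tds e))))
  where
  colSum≡1 : M F.zero j ≡ true → colSum M j ≡ 1
  colSum≡1 e rewrite e = refl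

wide⇒≤ : ∀ {n m} → 5 * n ≤ 3 * m + 3 → n ≤ m
wide⇒≤ {n} {m} wide =
  ≤-pred (*-cancelˡ-< 5 n (suc m) (≤-<-trans wide (subst (3 * m + 3 <_) (sym (identity m)) (m<m+n _ (s≤s z≤n)))))
  where
  identity : ∀ m → 5 * suc m ≡ 3 * m + 3 + suc (2 * m + 1)
  identity = solve-∀

wide-bound : ∀ {n m} → 5 * n ≤ 3 * m + 3 → (M : Matrix n m) → IsKTDS 2 M → n * 2 ≤ ones M
wide-bound {n} {m} wide M tds with ones-lowerBound M tds
... | inj₁ m*2≤ = ≤-trans (*-monoˡ-≤ 2 (wide⇒≤ {n} {m} wide)) m*2≤
... | inj₂ (inj₁ n*2≤) = n*2≤
... | inj₂ (inj₂ (bound , _)) = 4*m≤4*n+3⇒m≤n (n * 2) (ones M) (begin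
  4 * (n * 2)          ≡⟨ e₁ n ⟩
  3 * n + 5 * n        ≤⟨ +-monoʳ-≤ (3 * n) wide ⟩
  3 * n + (3 * m + 3)  ≡⟨ e₂ n m ⟩
  (n + m) * 3 + 3      ≤⟨ +-monoˡ-≤ 3 bound ⟩
  4 * ones M + 3       ∎)
  where
  open ≤-Reasoning
  e₁ : ∀ n → 4 * (n * 2) ≡ 3 * n + 5 * n
  e₁ = solve-∀
  e₂ : ∀ n m → 3 * n + (3 * m + 3) ≡ (n + m) * 3 + 3
  e₂ = solve-∀

NearOptimal⇒≤ : ∀ {n m c} → NearOptimal n m c → 4 * c ≤ (n + m) * 3 + 4
NearOptimal⇒≤ {n} {m} (inj₁ h)       = ≤-trans h (+-monoʳ-≤ ((n + m) * 3) (n≤1+n 3))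
NearOptimal⇒≤         (inj₂ (eq , _)) = ≤-reflexive eq

c≤m*2 : ∀ {n m c} → 4 * c ≤ (n + m) * 3 + 4 → 3 * n + 4 ≤ 5 * m → c ≤ m * 2
c≤m*2 {n} {m} {c} h n-side = *-cancelˡ-≤ 4 (begin
  4 * c                  ≤⟨ h ⟩
  (n + m) * 3 + 4        ≡⟨ e₁ n m ⟩
  3 * n + 4 + 3 * m      ≤⟨ +-monoˡ-≤ (3 * m) n-side ⟩
  5 * m + 3 * m          ≡⟨ e₂ m ⟩
  4 * (m * 2)            ∎)
  where
  open ≤-Reasoning
  e₁ : ∀ n m → (n + m) * 3 + 4 ≡ 3 * n + 4 + 3 * m
  e₁ = solve-∀
  e₂ : ∀ m → 5 * m + 3 * m ≡ 4 * (m * 2)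
  e₂ = solve-∀

cone-bound : ∀ {n m c} → InCone n m → NearOptimal n m c → (M : Matrix n m) → IsKTDS 2 M → c ≤ ones M
cone-bound {n} {m} {c} (m-side , n-side) near M tds with ones-lowerBound M tds
... | inj₁ m*2≤ = ≤-trans (c≤m*2 {n} {m} (NearOptimal⇒≤ {n} {m} {c} near) n-side) m*2≤
... | inj₂ (inj₁ n*2≤) =
  ≤-trans (c≤m*2 {m} {n} (subst (λ s → 4 * c ≤ s * 3 + 4) (+-comm n m) (NearOptimal⇒≤ {n} {m} {c} near)) m-side) n*2≤
... | inj₂ (inj₂ (bound , tight)) with near
...   | inj₁ h = 4*m≤4*n+3⇒m≤n c (ones M) (≤-trans h (+-monoˡ-≤ 3 bound))
...   | inj₂ (eq , ¬perfect) = 4*m≤4*n+3⇒m≤n c (ones M) (begin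
  4 * c                    ≡⟨ eq ⟩
  (n + m) * 3 + 4          ≡⟨ +-suc ((n + m) * 3) 3 ⟩
  suc ((n + m) * 3) + 3    ≤⟨ +-monoˡ-≤ 3 (≤∧≢⇒< bound (¬perfect ∘ tight ∘ sym)) ⟩
  4 * ones M + 3           ∎)
  where open ≤-Reasoning

Result : ℕ → ℕ → Set
Result n m = ∃[ M ] (IsMinKTDS {n} {m} 2 M × (PermEq M B33 ⊎ AllComponentsAllowed M))

cone-result : ∀ {n m} → InCone n m → ¬ (n ≡ 3 × m ≡ 3) → Result n m
cone-result {n} {m} cone ≢33 with construct n m cone ≢33
... | c , X , near = Tiling.matrix X ,
  (Tiling.isTDS X , λ M tds → subst (_≤ ones M) (sym (Tiling.ones≡ X)) (cone-bound cone near M tds)) ,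
  inj₂ (Tiling.allowed X)

B33-result : Result 3 3
B33-result =
  B33 ,
  (from-yes (all? λ i → all? λ j → 2 ≤? κ B33 i j) ,
   cone-bound {c = 5} (≤ᵇ⇒≤ _ _ _ , ≤ᵇ⇒≤ _ _ _) (inj₁ (≤ᵇ⇒≤ _ _ _))) ,
  inj₁ (id , id , id , id , (λ r → mk⇔ (λ _ → r , refl) _) , (λ c → mk⇔ (λ _ → c , refl) _) , λ _ _ → refl)

padCols-result : ∀ {n y} k (A : Matrix n y) → IsKTDS 2 A → (∀ i → 2 ≤ rowSum A i) → AllComponentsAllowed A →
  (∀ (M : Matrix n (k + y)) → IsKTDS 2 M → ones A ≤ ones M) → Result n (k + y)
padCols-result k A tds rows ok lower =
  zeros 0 k ⊕ A ,
  (KTDS-⊕ (λ ()) tds (λ ()) (λ i j → ≤-trans (rows i) (m≤m+n _ _)) ,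
   λ M t → subst (_≤ ones M) (sym ones-⊕) (lower M t)) ,
  inj₂ (allowed-⊕ (λ ()) ok)
  where open DirectSum (zeros 0 k) A

padRows-result : ∀ {x m} k (A : Matrix x m) → IsKTDS 2 A → (∀ j → 2 ≤ colSum A j) → AllComponentsAllowed A →
  (∀ (M : Matrix (k + x) m) → IsKTDS 2 M → ones A ≤ ones M) → Result (k + x) m
padRows-result k A tds cols ok lower =
  zeros k 0 ⊕ A ,
  (KTDS-⊕ (λ _ ()) tds (λ _ j → cols j) (λ _ ()) ,
   λ M t → subst (_≤ ones M) (sym (trans ones-⊕ (cong (_+ ones A) (sumFin-zero k)))) (lower M t)) ,
  inj₂ (allowed-⊕ (λ _ ()) ok)
  where open DirectSum (zeros k 0) A

singleRow-result : ∀ k → Result 1 (k + 3)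
singleRow-result k =
  padCols-result k (J 1 3) (KTDS-J 1 3 ≤-refl) (λ _ → ≤ᵇ⇒≤ 2 3 _) (allowed-J 1 3 (inj₂ (inj₁ (refl , ≤-refl))))
    (λ M t → singleRow-bound M t (≤-trans (s≤s z≤n) (m≤n+m 3 k)) (s≤s z≤n))

singleCol-result : ∀ k → Result (k + 3) 1
singleCol-result k =
  padRows-result k (J 3 1) (KTDS-J 3 1 ≤-refl) (λ _ → ≤ᵇ⇒≤ 2 3 _) (allowed-J 3 1 (inj₁ (refl , ≤-refl)))
    (λ M t → subst (3 ≤_) (ones-transpose M)
               (singleRow-bound (transpose M) (transpose-KTDS M t) (≤-trans (s≤s z≤n) (m≤n+m 3 k)) (s≤s z≤n)))

wide-result : ∀ {n} k → 2 ≤ n → 5 * n ≤ 3 * (k + 2) + 3 → Result n (k + 2)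
wide-result {n} k 2≤n wide =
  padCols-result k (J n 2) (KTDS-J n 2 (+-monoˡ-≤ 2 2≤n)) (λ i → ≤-reflexive (sym (rowSum-J n 2 i)))
    (allowed-J n 2 (inj₂ (inj₂ (inj₁ (refl , 2≤n)))))
    (λ M t → subst (_≤ ones M) (sym (ones-J n 2)) (wide-bound wide M t))

tall-result : ∀ {m} k → 2 ≤ m → 5 * m ≤ 3 * (k + 2) + 3 → Result (k + 2) m
tall-result {m} k 2≤m tall =
  padRows-result k (J 2 m) (KTDS-J 2 m (s≤s (s≤s 2≤m))) (λ j → ≤-reflexive (sym (colSum-J 2 m j)))
    (allowed-J 2 m (inj₂ (inj₂ (inj₂ (refl , 2≤m)))))
    (λ M t → subst₂ _≤_ (trans (*-comm m 2) (sym (ones-J 2 m))) (ones-transpose M)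
               (wide-bound tall (transpose M) (transpose-KTDS M t)))

≰⇒+4≤ : ∀ {a b} → ¬ a ≤ b + 3 → b + 4 ≤ a
≰⇒+4≤ {a} {b} a≰b+3 = subst (_≤ a) (sym (+-suc b 3)) (≰⇒> a≰b+3)

≥1∧≢1⇒≥2 : ∀ {k} → k ≥ 1 → k ≢ 1 → k ≥ 2
≥1∧≢1⇒≥2 k≥1 k≢1 = ≤∧≢⇒< k≥1 (k≢1 ∘ sym)

≥2∧≢2⇒≥3 : ∀ {k} → k ≥ 2 → k ≢ 2 → k ≥ 3
≥2∧≢2⇒≥3 k≥2 k≢2 = ≤∧≢⇒< k≥2 (k≢2 ∘ sym)

theorem7 : (n m : ℕ) → n ≥ 1 → m ≥ 1 →
    ¬ (n ≡ 1 × m ≡ 1) → ¬ (n ≡ 1 × m ≡ 2) → ¬ (n ≡ 2 × m ≡ 1) →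
    ∃[ M ] (IsMinKTDS {n} {m} 2 M × (PermEq M B33 ⊎ AllComponentsAllowed M))
theorem7 n m n≥1 m≥1 ≢11 ≢12 ≢21 with n ≟ 1 | m ≟ 1
... | yes refl | _ with ≤⇒∃+ (≥2∧≢2⇒≥3 (≥1∧≢1⇒≥2 m≥1 (λ m≡1 → ≢11 (refl , m≡1))) (λ m≡2 → ≢12 (refl , m≡2)))
...   | k , refl = singleRow-result k
theorem7 n m n≥1 m≥1 ≢11 ≢12 ≢21 | no n≢1 | yes refl
  with ≤⇒∃+ (≥2∧≢2⇒≥3 (≥1∧≢1⇒≥2 n≥1 n≢1) (λ n≡2 → ≢21 (n≡2 , refl)))
...   | k , refl = singleCol-result k
theorem7 n m n≥1 m≥1 _ _ _ | no n≢1 | no m≢1 with 5 * n ≤? 3 * m + 3 | 5 * m ≤? 3 * n + 3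
... | yes wide | _ with ≤⇒∃+ (≥1∧≢1⇒≥2 m≥1 m≢1)
...   | k , refl = wide-result k (≥1∧≢1⇒≥2 n≥1 n≢1) wide
theorem7 n m n≥1 m≥1 _ _ _ | no n≢1 | no m≢1 | no _ | yes tall with ≤⇒∃+ (≥1∧≢1⇒≥2 n≥1 n≢1)
...   | k , refl = tall-result k (≥1∧≢1⇒≥2 m≥1 m≢1) tall
theorem7 n m _ _ _ _ _ | no _ | no _ | no ¬wide | no ¬tall with (n ≟ 3) ×-dec (m ≟ 3)
... | yes (refl , refl) = B33-result
... | no ≢33 = cone-result (≰⇒+4≤ ¬wide , ≰⇒+4≤ ¬tall) ≢33
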